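{- Let $n$ be a natural number, $P$ a predicate on families, and $Q$ a predicate on pairs (family, set) that incrementally checks $P$. Then for every list $[l_0,\ldots,l_m]$ of natural numbers, $$\mathcal{L}([l_0,\ldots,l_{m-1},l_m+1],n,P)=\bigcup_{A\in \mathcal{S}(n,m)}\{F\cup\{A\} : F\in\mathcal{L}([l_0,\ldots,l_m],n,P),\ A\notin F,\ Q\,F\,A\}.$$
   Context: All sets and families are finite; sets are sets of natural numbers and $[n]=\{0,1,\ldots,n-1\}$. A family $F$ is over $[n]$ if $\bigcup F\subseteq[n]$. For a list $L=[l_0,\ldots,l_m]$, a family $F$ is $L$-partitioned if every $A\in F$ has $|A|\le m$ and, for each $0\le i\le m$, exactly $l_i$ members of $F$ have exactly $i$ elements (for the empty list this means $F=\emptyset$). $\mathcal{L}(L,n,P)$ denotes the collection of all $L$-partitioned families over $[n]$ satisfying $P$. $\mathcal{S}(n,m)$ denotes the collection of all $A\subseteq[n]$ with $|A|=m$. The predicate $Q$ incrementally checks $P$ if for every family $F$ and set $A$ such that $|A|\ge|A'|$ for all $A'\in F$ and $A\notin F$, we have $P(F\cup\{A\})\iff (P(F)\text{ and } Q\,F\,A)$. -}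

module Defs where

open import Data.Nat using (ℕ; zero; suc; _<_; _≤_; _<ᵇ_; _≡ᵇ_)
open import Data.Nat.Properties using (_≟_)
open import Data.Bool using (Bool; true; false; T; _∧_; _∨_)
open import Data.Unit using (tt)
open import Data.List using (List; []; _∷_; length; filter; lookup)
open import Data.List.Membership.Propositional using (_∈_)
open import Data.Fin using (Fin; toℕ)
open import Data.Product using (_×_; _,_)
open import Relation.Binary.PropositionalEquality using (_≡_; refl)
open import Relation.Nullary using (¬_)
open import Function.Bundles using (_⇔_)

-- Canonical representation of finite sets of naturals and of finite
-- families of such sets: strictly sorted lists (sortedness is a
-- Bool-valued check, so its proof is unique and _≡_ is set equality).

sortedBy : {A : Set} → (A → A → Bool) → List A → Bool
sortedBy r [] = true
sortedBy r (x ∷ []) = true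
sortedBy r (x ∷ y ∷ ys) = r x y ∧ sortedBy r (y ∷ ys)

record FinSet : Set where
  constructor mkSet
  field
    elems  : List ℕ
    sorted : T (sortedBy _<ᵇ_ elems)
open FinSet public

-- strict lexicographic order on lists of naturals (used only to fix a
-- canonical order of the members of a family)
_<ᴸ_ : List ℕ → List ℕ → Bool
[] <ᴸ [] = false
[] <ᴸ (_ ∷ _) = true
(_ ∷ _) <ᴸ [] = false
(x ∷ xs) <ᴸ (y ∷ ys) = (x <ᵇ y) ∨ ((x ≡ᵇ y) ∧ (xs <ᴸ ys))

_<ˢ_ : FinSet → FinSet → Bool
A <ˢ B = elems A <ᴸ elems B

record Family : Set where
  constructor mkFamily
  field
    members : List FinSet
    sortedF : T (sortedBy _<ˢ_ members)
open Family public

_∈ˢ_ : ℕ → FinSet → Set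
x ∈ˢ A = x ∈ elems A

_∈ᶠ_ : FinSet → Family → Set
A ∈ᶠ F = A ∈ members F

∣_∣ : FinSet → ℕ
∣ A ∣ = length (elems A)

insertRaw : FinSet → List FinSet → List FinSet
insertRaw a [] = a ∷ []
insertRaw a (b ∷ bs) with a <ˢ b | b <ˢ a
... | true  | _     = a ∷ b ∷ bs
... | false | true  = b ∷ insertRaw a bs
... | false | false = b ∷ bs   -- a = b already present

private
  ∧-intro : ∀ {x y} → T x → T y → T (x ∧ y)
  ∧-intro {true} {true} _ _ = tt

  ∧-l : ∀ {x y} → T (x ∧ y) → T x
  ∧-l {true} _ = tt

  ∧-r : ∀ {x y} → T (x ∧ y) → T y
  ∧-r {true} p = p

  tail-sorted : ∀ b bs → T (sortedBy _<ˢ_ (b ∷ bs)) → T (sortedBy _<ˢ_ bs)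
  tail-sorted b [] _ = tt
  tail-sorted b (c ∷ cs) p = ∧-r p

  T≡ : ∀ {x} → x ≡ true → T x
  T≡ refl = tt

  lemma : ∀ a b bs → T (b <ˢ a) → T (sortedBy _<ˢ_ (b ∷ bs)) →
          T (sortedBy _<ˢ_ (b ∷ insertRaw a bs))
  lemma a b [] ba _ = ∧-intro ba tt
  lemma a b (c ∷ cs) ba p with a <ˢ c in e1 | c <ˢ a in e2
  ... | true  | _     = ∧-intro ba (∧-intro (T≡ e1) (∧-r p))
  ... | false | true  = ∧-intro (∧-l p) (lemma a c cs (T≡ e2) (∧-r p))
  ... | false | false = p

insertRaw-sorted : ∀ a bs → T (sortedBy _<ˢ_ bs) → T (sortedBy _<ˢ_ (insertRaw a bs))
insertRaw-sorted a [] _ = tt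
insertRaw-sorted a (b ∷ bs) p with a <ˢ b in e1 | b <ˢ a in e2
... | true  | _     = ∧-intro (T≡ e1) p
... | false | true  = lemma a b bs (T≡ e2) p
... | false | false = p

_∪｛_｝ : Family → FinSet → Family
F ∪｛ A ｝ = mkFamily (insertRaw A (members F)) (insertRaw-sorted A (members F) (sortedF F))

OverN : ℕ → Family → Set
OverN n F = ∀ A → A ∈ᶠ F → ∀ x → x ∈ˢ A → x < n

-- F is L-partitioned, L = [l_0,…,l_m] (length L = m+1): every member has
-- at most m elements, and for each i ≤ m exactly l_i members have i elements.
-- (For L = [] this forces F = ∅.)
Partitioned : List ℕ → Family → Set
Partitioned L F =
  (∀ A → A ∈ᶠ F → ∣ A ∣ < length L) ×
  (∀ (i : Fin (length L)) →
     length (filter (λ A → ∣ A ∣ ≟ toℕ i) (members F)) ≡ lookup L i)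

𝓛 : List ℕ → ℕ → (Family → Set) → Family → Set
𝓛 L n P F = Partitioned L F × OverN n F × P F

𝓢 : ℕ → ℕ → FinSet → Set
𝓢 n m A = (∀ x → x ∈ˢ A → x < n) × ∣ A ∣ ≡ m

IncrementallyChecks : (Family → Set) → (Family → FinSet → Set) → Set
IncrementallyChecks P Q =
  ∀ (F : Family) (A : FinSet) →
    (∀ A′ → A′ ∈ᶠ F → ∣ A′ ∣ ≤ ∣ A ∣) →
    ¬ (A ∈ᶠ F) →
    (P (F ∪｛ A ｝) ⇔ (P F × Q F A))

{-# OPTIONS --safe #-}
-- Write m = length ls. Members of a family are kept as a strictly sorted list, and for
-- A ∉ F the list of F ∪ {A} is a permutation of A ∷ members F; so membership and the
-- number of members of each size behave as for A ∷ members F. Adding a set of size m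
-- therefore turns an [l₀,…,lₘ]-partitioned family into an [l₀,…,lₘ+1]-partitioned one
-- and back, and since A has maximal size, incrementality splits P (F ∪ {A}) into P F and
-- Q F A. Conversely a family with lₘ + 1 members of size m has such a member B, and
-- deleting B from its sorted member list gives F with B ∉ F and G = F ∪ {B}.
module Submission where

open import Defs
open import Data.Nat using (ℕ; suc; _<_; _≤_; s≤s)
open import Data.Nat.Properties as ℕ using (_≟_; <ᵇ⇒<; <⇒<ᵇ; ≡ᵇ⇒≡; ≡⇒≡ᵇ; suc-injective; +-comm)
open import Data.Bool using (Bool; true; false; T)
open import Data.Bool.Properties using (T-∨; T-∧; T-≡; T-irrelevant)
open import Data.Empty using (⊥-elim)
open import Data.Sum using (inj₁; inj₂)
open import Data.Product using (Σ; _×_; _,_; proj₁; proj₂)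
open import Data.Fin using (Fin; toℕ; zero; suc)
open import Data.Fin.Properties using (toℕ<n)
open import Data.List using (List; []; _∷_; length; _∷ʳ_; filter; lookup)
open import Data.List.Properties using (length-++; filter-accept; filter-reject)
open import Data.List.Relation.Unary.Any using (here; there)
open import Data.List.Relation.Unary.All as All using (All; []; _∷_)
open import Data.List.Relation.Unary.AllPairs using (AllPairs; []; _∷_)
open import Data.List.Relation.Unary.Linked using (Linked; []; [-]; _∷_)
open import Data.List.Relation.Unary.Linked.Properties using (Linked⇒AllPairs; AllPairs⇒Linked)
open import Data.List.Relation.Binary.Lex.Strict as Lex using (Lex-<; halt; this; next)
open import Data.List.Relation.Binary.Pointwise using (Pointwise-≡⇒≡; ≡⇒Pointwise-≡)
open import Data.List.Relation.Binary.Permutation.Propositional using (_↭_; prep; swap; ↭-refl; ↭-trans; ↭-sym)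
open import Data.List.Relation.Binary.Permutation.Propositional.Properties using (∈-resp-↭; ↭-length; filter-↭)
open import Data.List.Membership.Propositional using (_∈_)
open import Data.List.Membership.Propositional.Properties using (∈-filter⁻)
open import Relation.Binary using (IsStrictTotalOrder; tri<; tri≈; tri>)
open import Relation.Binary.PropositionalEquality using (_≡_; _≢_; refl; sym; trans; cong; subst)
open import Relation.Nullary using (¬_)
open import Function.Bundles using (_⇔_; mk⇔; Equivalence)


<ᴸ⇒Lex-< : ∀ xs ys → T (xs <ᴸ ys) → Lex-< _≡_ _<_ xs ys
<ᴸ⇒Lex-< [] (y ∷ ys) _ = halt
<ᴸ⇒Lex-< (x ∷ xs) (y ∷ ys) p with Equivalence.to T-∨ p
... | inj₁ x<ᵇy = this (<ᵇ⇒< x y x<ᵇy)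
... | inj₂ q with Equivalence.to T-∧ q
...   | x≡ᵇy , xs<ys = next (≡ᵇ⇒≡ x y x≡ᵇy) (<ᴸ⇒Lex-< xs ys xs<ys)

Lex-<⇒<ᴸ : ∀ {xs ys} → Lex-< _≡_ _<_ xs ys → T (xs <ᴸ ys)
Lex-<⇒<ᴸ halt = _
Lex-<⇒<ᴸ (this x<y) = Equivalence.from T-∨ (inj₁ (<⇒<ᵇ x<y))
Lex-<⇒<ᴸ {x ∷ _} (next refl xs<ys) =
  Equivalence.from T-∨ (inj₂ (Equivalence.from T-∧ (≡⇒≡ᵇ x x refl , Lex-<⇒<ᴸ xs<ys)))

private
  module LexOrder = IsStrictTotalOrder (Lex.<-isStrictTotalOrder ℕ.<-isStrictTotalOrder)

_≺_ : FinSet → FinSet → Set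
A ≺ B = T (A <ˢ B)

elems-injective : ∀ {A B} → elems A ≡ elems B → A ≡ B
elems-injective {mkSet xs p} {mkSet .xs q} refl = cong (mkSet xs) (T-irrelevant p q)

≺⇒Lex-< : ∀ {A B} → A ≺ B → Lex-< _≡_ _<_ (elems A) (elems B)
≺⇒Lex-< {A} {B} = <ᴸ⇒Lex-< (elems A) (elems B)

≺-trans : ∀ {A B C} → A ≺ B → B ≺ C → A ≺ C
≺-trans {A} {B} {C} A≺B B≺C =
  Lex-<⇒<ᴸ (LexOrder.trans (≺⇒Lex-< {A} {B} A≺B) (≺⇒Lex-< {B} {C} B≺C))

≺-irrefl : ∀ {A} → ¬ A ≺ A
≺-irrefl {A} A≺A = LexOrder.irrefl (≡⇒Pointwise-≡ refl) (≺⇒Lex-< {A} {A} A≺A)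

≺-asym : ∀ {A B} → A ≺ B → ¬ B ≺ A
≺-asym {A} {B} A≺B B≺A = ≺-irrefl {A} (≺-trans {A} {B} {A} A≺B B≺A)

¬≺∧¬≻⇒≡ : ∀ {A B} → ¬ A ≺ B → ¬ B ≺ A → A ≡ B
¬≺∧¬≻⇒≡ {A} {B} A⊀B B⊀A with LexOrder.compare (elems A) (elems B)
... | tri< A<B _ _ = ⊥-elim (A⊀B (Lex-<⇒<ᴸ A<B))
... | tri≈ _ A≋B _ = elems-injective (Pointwise-≡⇒≡ A≋B)
... | tri> _ _ B<A = ⊥-elim (B⊀A (Lex-<⇒<ᴸ B<A))


Sorted : List FinSet → Set
Sorted = AllPairs _≺_

sortedBy⇒Linked : ∀ {A : Set} {r : A → A → Bool} xs → T (sortedBy r xs) → Linked (λ x y → T (r x y)) xs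
sortedBy⇒Linked [] _ = []
sortedBy⇒Linked (x ∷ []) _ = [-]
sortedBy⇒Linked (x ∷ xs@(_ ∷ _)) p =
  proj₁ (Equivalence.to T-∧ p) ∷ sortedBy⇒Linked xs (proj₂ (Equivalence.to T-∧ p))

Linked⇒sortedBy : ∀ {A : Set} {r : A → A → Bool} {xs} → Linked (λ x y → T (r x y)) xs → T (sortedBy r xs)
Linked⇒sortedBy [] = _
Linked⇒sortedBy [-] = _
Linked⇒sortedBy (rxy ∷ rest) = Equivalence.from T-∧ (rxy , Linked⇒sortedBy rest)

members-sorted : ∀ F → Sorted (members F)
members-sorted F = Linked⇒AllPairs (λ {A} {B} {C} → ≺-trans {A} {B} {C}) (sortedBy⇒Linked (members F) (sortedF F))

insertRaw-↭ : ∀ {A} xs → ¬ A ∈ xs → insertRaw A xs ↭ A ∷ xs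
insertRaw-↭ [] _ = ↭-refl
insertRaw-↭ {A} (B ∷ xs) A∉ with A <ˢ B in A<B | B <ˢ A in B<A
... | true  | _     = ↭-refl
... | false | true  = ↭-trans (prep B (insertRaw-↭ xs (λ A∈ → A∉ (there A∈)))) (swap B A ↭-refl)
... | false | false = ⊥-elim (A∉ (here (¬≺∧¬≻⇒≡ {A} {B} (subst T A<B) (subst T B<A))))

insertRaw-min : ∀ {A} xs → All (A ≺_) xs → insertRaw A xs ≡ A ∷ xs
insertRaw-min [] _ = refl
insertRaw-min {A} (B ∷ xs) (A≺B ∷ _) with A <ˢ B
... | true = refl

insertRaw-past : ∀ {A B} xs → B ≺ A → insertRaw A (B ∷ xs) ≡ B ∷ insertRaw A xs
insertRaw-past {A} {B} xs B≺A with A <ˢ B in A<B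
... | true = ⊥-elim (≺-asym {B} {A} B≺A (Equivalence.from T-≡ A<B))
... | false with B <ˢ A
...   | true = refl

∈-sorted⇒insertRaw : ∀ {A xs} → Sorted xs → A ∈ xs →
  Σ (List FinSet) λ ys → Sorted ys × ¬ A ∈ ys × insertRaw A ys ≡ xs
∈-sorted⇒insertRaw {A} {_ ∷ xs} (A≺xs ∷ xs-sorted) (here refl) =
  xs , xs-sorted , (λ A∈xs → ≺-irrefl {A} (All.lookup A≺xs A∈xs)) , insertRaw-min xs A≺xs
∈-sorted⇒insertRaw {A} {B ∷ xs} (B≺xs ∷ xs-sorted) (there A∈xs)
  with ∈-sorted⇒insertRaw xs-sorted A∈xs
... | ys , ys-sorted , A∉ys , A+ys≡xs =
  B ∷ ys , All.tabulate B≺ys ∷ ys-sorted , A∉B∷ys ,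
  trans (insertRaw-past ys B≺A) (cong (B ∷_) A+ys≡xs)
  where
  B≺A : B ≺ A
  B≺A = All.lookup B≺xs A∈xs
  B≺ys : ∀ {C} → C ∈ ys → B ≺ C
  B≺ys C∈ys = All.lookup B≺xs
    (subst (_ ∈_) A+ys≡xs (∈-resp-↭ (↭-sym (insertRaw-↭ ys A∉ys)) (there C∈ys)))
  A∉B∷ys : ¬ A ∈ B ∷ ys
  A∉B∷ys (here refl) = ≺-irrefl {A} B≺A
  A∉B∷ys (there A∈ys) = A∉ys A∈ys


Family-≡ : ∀ {F G} → members F ≡ members G → F ≡ G
Family-≡ {mkFamily xs p} {mkFamily .xs q} refl = cong (mkFamily xs) (T-irrelevant p q)

∈ᶠ⇒≡∪｛｝ : ∀ {A G} → A ∈ᶠ G → Σ Family λ F → ¬ A ∈ᶠ F × G ≡ F ∪｛ A ｝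
∈ᶠ⇒≡∪｛｝ {G = G} A∈G with ∈-sorted⇒insertRaw (members-sorted G) A∈G
... | ys , ys-sorted , A∉ys , A+ys≡G =
  mkFamily ys (Linked⇒sortedBy (AllPairs⇒Linked ys-sorted)) , A∉ys , Family-≡ (sym A+ys≡G)

∀∈ᶠ-∪｛｝ : ∀ {R : FinSet → Set} {A} F → ¬ A ∈ᶠ F →
  (∀ C → C ∈ᶠ (F ∪｛ A ｝) → R C) ⇔ (R A × (∀ C → C ∈ᶠ F → R C))
∀∈ᶠ-∪｛｝ {R} {A} F A∉F = mk⇔ to from
  where
  insert-↭ : members (F ∪｛ A ｝) ↭ A ∷ members F
  insert-↭ = insertRaw-↭ (members F) A∉F
  to : (∀ C → C ∈ᶠ (F ∪｛ A ｝) → R C) → R A × (∀ C → C ∈ᶠ F → R C)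
  to H = H A (∈-resp-↭ (↭-sym insert-↭) (here refl))
       , λ C C∈F → H C (∈-resp-↭ (↭-sym insert-↭) (there C∈F))
  from : R A × (∀ C → C ∈ᶠ F → R C) → ∀ C → C ∈ᶠ (F ∪｛ A ｝) → R C
  from (RA , H) C C∈F∪A with ∈-resp-↭ insert-↭ C∈F∪A
  ... | here refl = RA
  ... | there C∈F = H C C∈F


#ofSize : ℕ → List FinSet → ℕ
#ofSize k xs = length (filter (λ A → ∣ A ∣ ≟ k) xs)

#ofSize-∷-≡ : ∀ {k} A xs → ∣ A ∣ ≡ k → #ofSize k (A ∷ xs) ≡ suc (#ofSize k xs)
#ofSize-∷-≡ {k} A xs ∣A∣≡k = cong length (filter-accept (λ A → ∣ A ∣ ≟ k) {A} {xs} ∣A∣≡k)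

#ofSize-∷-≢ : ∀ {k} A xs → ∣ A ∣ ≢ k → #ofSize k (A ∷ xs) ≡ #ofSize k xs
#ofSize-∷-≢ {k} A xs ∣A∣≢k = cong length (filter-reject (λ A → ∣ A ∣ ≟ k) {A} {xs} ∣A∣≢k)

#ofSize-∪｛｝ : ∀ {k A} F → ¬ A ∈ᶠ F →
  #ofSize k (members (F ∪｛ A ｝)) ≡ #ofSize k (A ∷ members F)
#ofSize-∪｛｝ F A∉F = ↭-length (filter-↭ _ (insertRaw-↭ (members F) A∉F))

#ofSize≡suc⇒∈ : ∀ {k c} xs → #ofSize k xs ≡ suc c → Σ FinSet λ A → A ∈ xs × ∣ A ∣ ≡ k
#ofSize≡suc⇒∈ {k} xs #≡suc with filter (λ A → ∣ A ∣ ≟ k) xs in filtered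
... | A ∷ _ = A , ∈-filter⁻ (λ A → ∣ A ∣ ≟ k) (subst (A ∈_) (sym filtered) (here refl))


Matches : (ℕ → ℕ) → List ℕ → Set
Matches c L = ∀ (i : Fin (length L)) → c (toℕ i) ≡ lookup L i

Matches-∷ʳ : ∀ c ls x → Matches c (ls ∷ʳ x) ⇔ (Matches c ls × c (length ls) ≡ x)
Matches-∷ʳ c [] x = mk⇔ (λ H → (λ ()) , H zero) (λ { (_ , c0≡x) zero → c0≡x })
Matches-∷ʳ c (l ∷ ls) x = mk⇔ to from
  where
  IH = Matches-∷ʳ (λ k → c (suc k)) ls x
  to : Matches c (l ∷ ls ∷ʳ x) → Matches c (l ∷ ls) × c (suc (length ls)) ≡ x
  to H with Equivalence.to IH (λ i → H (suc i))
  ... | Hls , Hx = (λ { zero → H zero ; (suc i) → Hls i }) , Hx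
  from : Matches c (l ∷ ls) × c (suc (length ls)) ≡ x → Matches c (l ∷ ls ∷ʳ x)
  from (H , _) zero = H zero
  from (H , Hx) (suc i) = Equivalence.from IH ((λ i → H (suc i)) , Hx) i

<length-∷ʳ : ∀ {k} (ls : List ℕ) (x : ℕ) → k < length (ls ∷ʳ x) ⇔ k ≤ length ls
<length-∷ʳ {k} ls x = mk⇔
  (λ k< → ℕ.≤-pred (subst (k <_) length-∷ʳ k<))
  (λ k≤ → subst (k <_) (sym length-∷ʳ) (s≤s k≤))
  where
  length-∷ʳ : length (ls ∷ʳ x) ≡ suc (length ls)
  length-∷ʳ = trans (length-++ ls) (+-comm (length ls) 1)

Partitioned-∷ʳ : ∀ F ls x → Partitioned (ls ∷ʳ x) F ⇔
  ((∀ C → C ∈ᶠ F → ∣ C ∣ ≤ length ls) ×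
   Matches (λ k → #ofSize k (members F)) ls × #ofSize (length ls) (members F) ≡ x)
Partitioned-∷ʳ F ls x = mk⇔
  (λ (bounded , counts) →
     (λ C C∈F → Equivalence.to (<length-∷ʳ ls x) (bounded C C∈F)) ,
     Equivalence.to (Matches-∷ʳ (λ k → #ofSize k (members F)) ls x) counts)
  (λ (bounded , counts) →
     (λ C C∈F → Equivalence.from (<length-∷ʳ ls x) (bounded C C∈F)) ,
     Equivalence.from (Matches-∷ʳ (λ k → #ofSize k (members F)) ls x) counts)

Partitioned-∪｛｝ : ∀ {A} F ls lm → ¬ A ∈ᶠ F → ∣ A ∣ ≡ length ls →
  Partitioned (ls ∷ʳ suc lm) (F ∪｛ A ｝) ⇔ Partitioned (ls ∷ʳ lm) F
Partitioned-∪｛｝ {A} F ls lm A∉F ∣A∣≡ = mk⇔ to from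
  where
  below : ∀ (i : Fin (length ls)) →
    #ofSize (toℕ i) (members (F ∪｛ A ｝)) ≡ #ofSize (toℕ i) (members F)
  below i = trans (#ofSize-∪｛｝ F A∉F)
    (#ofSize-∷-≢ A (members F) (λ ∣A∣≡i → ℕ.<-irrefl (trans (sym ∣A∣≡i) ∣A∣≡) (toℕ<n i)))
  at : #ofSize (length ls) (members (F ∪｛ A ｝)) ≡ suc (#ofSize (length ls) (members F))
  at = trans (#ofSize-∪｛｝ F A∉F) (#ofSize-∷-≡ A (members F) ∣A∣≡)
  to : Partitioned (ls ∷ʳ suc lm) (F ∪｛ A ｝) → Partitioned (ls ∷ʳ lm) F
  to part with Equivalence.to (Partitioned-∷ʳ (F ∪｛ A ｝) ls (suc lm)) part
  ... | bounded , counts , last = Equivalence.from (Partitioned-∷ʳ F ls lm)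
    ( proj₂ (Equivalence.to (∀∈ᶠ-∪｛｝ F A∉F) bounded)
    , (λ i → trans (sym (below i)) (counts i))
    , suc-injective (trans (sym at) last))
  from : Partitioned (ls ∷ʳ lm) F → Partitioned (ls ∷ʳ suc lm) (F ∪｛ A ｝)
  from part with Equivalence.to (Partitioned-∷ʳ F ls lm) part
  ... | bounded , counts , last = Equivalence.from (Partitioned-∷ʳ (F ∪｛ A ｝) ls (suc lm))
    ( Equivalence.from (∀∈ᶠ-∪｛｝ F A∉F) (ℕ.≤-reflexive ∣A∣≡ , bounded)
    , (λ i → trans (below i) (counts i))
    , trans at (cong suc last))

𝓛-∪｛｝ : ∀ {n P Q A F} ls lm → IncrementallyChecks P Q → ¬ A ∈ᶠ F → 𝓢 n (length ls) A →
  𝓛 (ls ∷ʳ suc lm) n P (F ∪｛ A ｝) ⇔ (𝓛 (ls ∷ʳ lm) n P F × Q F A)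
𝓛-∪｛｝ {n} {P} {Q} {A} {F} ls lm incremental A∉F (A⊆n , ∣A∣≡) = mk⇔ to from
  where
  P⇔ : Partitioned (ls ∷ʳ lm) F → P (F ∪｛ A ｝) ⇔ (P F × Q F A)
  P⇔ (bounded , _) = incremental F A
    (λ C C∈F → subst (∣ C ∣ ≤_) (sym ∣A∣≡) (Equivalence.to (<length-∷ʳ ls lm) (bounded C C∈F)))
    A∉F
  to : 𝓛 (ls ∷ʳ suc lm) n P (F ∪｛ A ｝) → 𝓛 (ls ∷ʳ lm) n P F × Q F A
  to (part , over , p) with Equivalence.to (Partitioned-∪｛｝ F ls lm A∉F ∣A∣≡) part
  ... | partF with Equivalence.to (P⇔ partF) p
  ...   | pF , q = (partF , proj₂ (Equivalence.to (∀∈ᶠ-∪｛｝ F A∉F) over) , pF) , q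
  from : 𝓛 (ls ∷ʳ lm) n P F × Q F A → 𝓛 (ls ∷ʳ suc lm) n P (F ∪｛ A ｝)
  from ((partF , overF , pF) , q) =
    Equivalence.from (Partitioned-∪｛｝ F ls lm A∉F ∣A∣≡) partF ,
    Equivalence.from (∀∈ᶠ-∪｛｝ F A∉F) (A⊆n , overF) ,
    Equivalence.from (P⇔ partF) (pF , q)

theorem3 : (n : ℕ) (P : Family → Set) (Q : Family → FinSet → Set) →
    IncrementallyChecks P Q →
    (ls : List ℕ) (lm : ℕ) (G : Family) →
    𝓛 (ls ∷ʳ suc lm) n P G ⇔
      Σ FinSet (λ A → 𝓢 n (length ls) A ×
        Σ Family (λ F → 𝓛 (ls ∷ʳ lm) n P F × ¬ (A ∈ᶠ F) × Q F A × G ≡ F ∪｛ A ｝))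
theorem3 n P Q incremental ls lm G = mk⇔ to from
  where
  Extension : Set
  Extension = Σ FinSet (λ A → 𝓢 n (length ls) A ×
    Σ Family (λ F → 𝓛 (ls ∷ʳ lm) n P F × ¬ (A ∈ᶠ F) × Q F A × G ≡ F ∪｛ A ｝))
  to : 𝓛 (ls ∷ʳ suc lm) n P G → Extension
  to 𝓛G@(partG , overG , _)
    with #ofSize≡suc⇒∈ (members G) (proj₂ (proj₂ (Equivalence.to (Partitioned-∷ʳ G ls (suc lm)) partG)))
  ... | B , B∈G , ∣B∣≡ with ∈ᶠ⇒≡∪｛｝ B∈G
  ...   | F , B∉F , G≡F∪B =
    let B∈𝓢 : 𝓢 n (length ls) B
        B∈𝓢 = overG B B∈G , ∣B∣≡
        (𝓛F , q) = Equivalence.to (𝓛-∪｛｝ ls lm incremental B∉F B∈𝓢)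
                     (subst (𝓛 (ls ∷ʳ suc lm) n P) G≡F∪B 𝓛G)
    in B , B∈𝓢 , F , 𝓛F , B∉F , q , G≡F∪B
  from : Extension → 𝓛 (ls ∷ʳ suc lm) n P G
  from (A , A∈𝓢 , F , 𝓛F , A∉F , q , refl) =
    Equivalence.from (𝓛-∪｛｝ ls lm incremental A∉F A∈𝓢) (𝓛F , q)
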